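{- If $G$ is a graph and $n \geq 1$, then \[ \sigma(G \vee K_n)= \begin{cases} \sigma(G) &\text{if $G$ is nonempty, and}\\ m &\text{if $G=\overline{K}_m$,} \end{cases} \] and the family $\{G \vee K_n\}_{n=1}^{\infty}$ is insensitive while $\{\overline{K}_m \vee K_n\}_{m=1}^{\infty}$ is sensitive.
   Context: All graphs are finite, undirected and simple. $K_n$ is the complete graph on $n$ vertices, $\overline{K}_m$ the empty (edgeless) graph on $m$ vertices; a graph is nonempty if it has at least one edge. $\vee$ denotes the join (disjoint union plus all edges between the two graphs). $\alpha(G)$ is the independence number and $\Delta(G)$ the maximum degree. The sensitivity of a nonempty graph $G=(V,E)$ is $\sigma(G)=\min\{\Delta(G[S]) : S\subseteq V,\ |S|>\alpha(G)\}$. An indexed family of graphs $G_n$ with $\Delta(G_n)\to\infty$ is sensitive if $\sigma(G_n)\to\infty$ and insensitive otherwise. -}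

module Defs where

open import Data.Nat using (ℕ; zero; suc; _+_; _≤_; _⊔_; _⊓_)
open import Data.Nat.Properties using (_<?_)
open import Data.Bool using (Bool; true; false; not; _∧_; if_then_else_)
open import Data.Fin using (Fin; zero; suc; splitAt; _≟_)
open import Data.Vec using (Vec; []; _∷_; lookup; tabulate)
open import Data.List using (List; []; _∷_; map; _++_; foldr)
open import Data.Maybe using (Maybe; just; nothing; fromMaybe)
open import Data.Sum using (_⊎_; inj₁; inj₂)
open import Data.Product using (∃; _×_; _,_)
open import Data.Empty using (⊥-elim)
open import Relation.Nullary using (¬_; yes; no)
open import Relation.Nullary.Decidable using (⌊_⌋)
open import Relation.Binary.PropositionalEquality using (_≡_; refl; sym)

record Graph : Set where
  field
    V      : ℕ
    adj    : Fin V → Fin V → Bool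
    adj-sym    : ∀ i j → adj i j ≡ adj j i
    adj-irrefl : ∀ i → adj i i ≡ false
open Graph public

Nonempty : Graph → Set
Nonempty G = ∃ λ i → ∃ λ j → adj G i j ≡ true

private
  eqb : ∀ {k} → Fin k → Fin k → Bool
  eqb i j = ⌊ i ≟ j ⌋

  eqb-sym : ∀ {k} (i j : Fin k) → eqb i j ≡ eqb j i
  eqb-sym i j with i ≟ j | j ≟ i
  ... | yes _ | yes _ = refl
  ... | no _  | no _  = refl
  ... | yes p | no q  = ⊥-elim (q (sym p))
  ... | no p  | yes q = ⊥-elim (p (sym q))

  eqb-refl : ∀ {k} (i : Fin k) → eqb i i ≡ true
  eqb-refl i with i ≟ i
  ... | yes _ = refl
  ... | no p  = ⊥-elim (p refl)

  notb-cong : ∀ {a b : Bool} → a ≡ b → not a ≡ not b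
  notb-cong refl = refl

  notb-true : ∀ {a : Bool} → a ≡ true → not a ≡ false
  notb-true refl = refl

K : ℕ → Graph
K n = record
  { V = n
  ; adj = λ i j → not (eqb i j)
  ; adj-sym = λ i j → notb-cong (eqb-sym i j)
  ; adj-irrefl = λ i → notb-true (eqb-refl i)
  }

Kbar : ℕ → Graph
Kbar m = record
  { V = m
  ; adj = λ _ _ → false
  ; adj-sym = λ _ _ → refl
  ; adj-irrefl = λ _ → refl
  }

private
  joinAdj : (G H : Graph) → Fin (V G + V H) → Fin (V G + V H) → Bool
  joinAdj G H i j with splitAt (V G) i | splitAt (V G) j
  ... | inj₁ a | inj₁ b = adj G a b
  ... | inj₂ a | inj₂ b = adj H a b
  ... | inj₁ _ | inj₂ _ = true
  ... | inj₂ _ | inj₁ _ = true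

  joinSym : (G H : Graph) → ∀ i j → joinAdj G H i j ≡ joinAdj G H j i
  joinSym G H i j with splitAt (V G) i | splitAt (V G) j
  ... | inj₁ a | inj₁ b = adj-sym G a b
  ... | inj₂ a | inj₂ b = adj-sym H a b
  ... | inj₁ _ | inj₂ _ = refl
  ... | inj₂ _ | inj₁ _ = refl

  joinIrr : (G H : Graph) → ∀ i → joinAdj G H i i ≡ false
  joinIrr G H i with splitAt (V G) i
  ... | inj₁ a = adj-irrefl G a
  ... | inj₂ a = adj-irrefl H a

_⋁_ : Graph → Graph → Graph
G ⋁ H = record
  { V = V G + V H
  ; adj = joinAdj G H
  ; adj-sym = joinSym G H
  ; adj-irrefl = joinIrr G H
  }

Subset : ℕ → Set
Subset k = Vec Bool k

allSubsets : (k : ℕ) → List (Subset k)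
allSubsets zero = [] ∷ []
allSubsets (suc k) = map (true ∷_) (allSubsets k) ++ map (false ∷_) (allSubsets k)

countFin : ∀ {k} → (Fin k → Bool) → ℕ
countFin {zero} p = 0
countFin {suc k} p = (if p zero then 1 else 0) + countFin (λ i → p (suc i))

maxFin : ∀ {k} → (Fin k → ℕ) → ℕ
maxFin {zero} f = 0
maxFin {suc k} f = f zero ⊔ maxFin (λ i → f (suc i))

allFinB : ∀ {k} → (Fin k → Bool) → Bool
allFinB {zero} p = true
allFinB {suc k} p = p zero ∧ allFinB (λ i → p (suc i))

∣_∣ : ∀ {k} → Subset k → ℕ
∣ S ∣ = countFin (lookup S)

degIn : (G : Graph) → Subset (V G) → Fin (V G) → ℕ
degIn G S v = countFin (λ u → lookup S u ∧ adj G v u)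

ΔS : (G : Graph) → Subset (V G) → ℕ
ΔS G S = maxFin (λ v → if lookup S v then degIn G S v else 0)

Δ : Graph → ℕ
Δ G = ΔS G (tabulate (λ _ → true))

isIndependent : (G : Graph) → Subset (V G) → Bool
isIndependent G S =
  allFinB (λ u → allFinB (λ v → not (lookup S u ∧ (lookup S v ∧ adj G u v))))

α : Graph → ℕ
α G = foldr (λ S acc → if isIndependent G S then ∣ S ∣ ⊔ acc else acc)
            0 (allSubsets (V G))

private
  minM : ℕ → Maybe ℕ → Maybe ℕ
  minM x nothing = just x
  minM x (just y) = just (x ⊓ y)

-- σ(G) = min { Δ(G[S]) : |S| > α(G) }.  The set is nonempty whenever G
-- is nonempty (take S = V); for edgeless G it is empty and σ G is
-- (conventionally, irrelevantly) 0.
σ : Graph → ℕ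
σ G = fromMaybe 0
  (foldr (λ S acc → if ⌊ α G <? ∣ S ∣ ⌋ then minM (ΔS G S) acc else acc)
         nothing (allSubsets (V G)))

TendsToInfinity : (ℕ → ℕ) → Set
TendsToInfinity f = ∀ B → ∃ λ N → ∀ k → N ≤ k → B ≤ f k

Sensitive : (ℕ → Graph) → Set
Sensitive F = TendsToInfinity (λ k → Δ (F k)) × TendsToInfinity (λ k → σ (F k))

Insensitive : (ℕ → Graph) → Set
Insensitive F = TendsToInfinity (λ k → Δ (F k)) × ¬ TendsToInfinity (λ k → σ (F k))

module Submission where

-- In G ⋁ K n every vertex of K n is adjacent to all other vertices. So an independent set
-- meeting K n is a single vertex, whence α (G ⋁ K n) = α G as soon as α G ≥ 1; and a set T
-- meeting K n has maximum degree ∣ T ∣ - 1, at least α whenever ∣ T ∣ > α. A set avoiding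
-- K n is a vertex set of G with the same induced degrees. Since σ G ≤ α G for nonempty G
-- (a maximum independent set plus one more vertex has α + 1 vertices, hence maximum degree
-- at most α), the minimum defining σ (G ⋁ K n) is attained by sets avoiding K n and equals
-- σ G. For G = Kbar m no vertex set of G exceeds α = m, so σ = m, attained by all of Kbar m
-- and one vertex of K n. In the families, Δ grows with the size of the graph, while V G
-- together with two vertices of K n exceeds α and has maximum degree at most V G + 1.

open import Defs
open import Algebra.Properties.CommutativeSemigroup as CommSemigroupProps using ()
open import Data.Bool as Bool using (Bool; true; false; not; _∧_; if_then_else_)
open import Data.Bool.Properties using (not-injective; not-¬; ¬-not; ∧-zeroʳ)
open import Data.Fin as Fin using (Fin; zero; suc; punchIn; _↑ˡ_; _↑ʳ_; splitAt)
open import Data.Fin.Properties using (punchInᵢ≢i; splitAt-↑ˡ; splitAt-↑ʳ; join-splitAt; any?)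
open import Data.Nat using (ℕ; zero; suc; _+_; _≤_; _<_; _⊔_; _⊓_; pred; z≤n; s≤s)
open import Data.Nat.Properties
open import Data.Product using (∃; _×_; _,_; proj₁; proj₂)
open import Data.Vec using ([]; _∷_; lookup; replicate; tabulate; _++_; _[_]≔_)
open import Data.Vec.Properties
  using (lookup-++ˡ; lookup-++ʳ; lookup-replicate; lookup∘update; lookup∘update′;
         lookup∘tabulate; tabulate∘lookup; tabulate-cong)
open import Data.List using (List; []; _∷_; map; foldr)
open import Data.List.Membership.Propositional using () renaming (_∈_ to _∈ₗ_)
open import Data.List.Membership.Propositional.Properties using (∈-map⁺; ∈-++⁺ˡ; ∈-++⁺ʳ)
open import Data.List.Relation.Unary.Any using (here; there)
open import Data.Maybe using (Maybe; just; nothing; fromMaybe)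
open import Data.Sum using (_⊎_; inj₁; inj₂)
open import Function using (_∘_)
open import Relation.Nullary using (¬_; Dec; yes; no; contradiction)
open import Relation.Nullary.Decidable using (⌊_⌋; dec-true; dec-false; isYes≗does)
open import Relation.Binary.PropositionalEquality

open CommSemigroupProps +-commutativeSemigroup using (x∙yz≈y∙xz)

⌊⌋≡true⇒ : ∀ {P : Set} (P? : Dec P) → ⌊ P? ⌋ ≡ true → P
⌊⌋≡true⇒ (yes p) _ = p

⇒⌊⌋≡true : ∀ {P : Set} (P? : Dec P) → P → ⌊ P? ⌋ ≡ true
⇒⌊⌋≡true P? p = trans (isYes≗does P?) (dec-true P? p)

∧-true⁻ : ∀ {a b} → a ∧ b ≡ true → a ≡ true × b ≡ true
∧-true⁻ {true} b = refl , b

indicator : Bool → ℕ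
indicator b = if b then 1 else 0

indicator≤1 : ∀ b → indicator b ≤ 1
indicator≤1 true = ≤-refl
indicator≤1 false = z≤n

indicator-mono : ∀ {a b} → (a ≡ true → b ≡ true) → indicator a ≤ indicator b
indicator-mono {false} _ = z≤n
indicator-mono {true} a⇒b rewrite a⇒b refl = ≤-refl

_⊆ᵇ_ : ∀ {k} → (Fin k → Bool) → (Fin k → Bool) → Set
p ⊆ᵇ q = ∀ i → p i ≡ true → q i ≡ true

countFin-cong : ∀ {k} {p q : Fin k → Bool} → (∀ i → p i ≡ q i) → countFin p ≡ countFin q
countFin-cong {zero} _ = refl
countFin-cong {suc k} p≗q = cong₂ _+_ (cong indicator (p≗q zero)) (countFin-cong (p≗q ∘ suc))

countFin-mono : ∀ {k} {p q : Fin k → Bool} → p ⊆ᵇ q → countFin p ≤ countFin q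
countFin-mono {zero} _ = z≤n
countFin-mono {suc k} p⊆q = +-mono-≤ (indicator-mono (p⊆q zero)) (countFin-mono (p⊆q ∘ suc))

countFin-false : ∀ {k} {p : Fin k → Bool} → (∀ i → p i ≡ false) → countFin p ≡ 0
countFin-false {zero} _ = refl
countFin-false {suc k} none rewrite none zero = countFin-false (none ∘ suc)

countFin-true : ∀ {k} {p : Fin k → Bool} → (∀ i → p i ≡ true) → countFin p ≡ k
countFin-true {zero} _ = refl
countFin-true {suc k} all rewrite all zero = cong suc (countFin-true (all ∘ suc))

countFin≤ : ∀ {k} (p : Fin k → Bool) → countFin p ≤ k
countFin≤ {k} p = subst (countFin p ≤_) (countFin-true {k} {λ _ → true} λ _ → refl)
                        (countFin-mono {k} {p} {λ _ → true} λ _ _ → refl)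

countFin-punchIn : ∀ {k} (p : Fin (suc k) → Bool) v →
                   countFin p ≡ indicator (p v) + countFin (p ∘ punchIn v)
countFin-punchIn p zero = refl
countFin-punchIn {suc k} p (suc v) = begin
  indicator (p zero) + countFin (p ∘ suc)
    ≡⟨ cong (indicator (p zero) +_) (countFin-punchIn (p ∘ suc) v) ⟩
  indicator (p zero) + (indicator (p (suc v)) + countFin (p ∘ suc ∘ punchIn v))
    ≡⟨ x∙yz≈y∙xz (indicator (p zero)) (indicator (p (suc v))) _ ⟩
  indicator (p (suc v)) + countFin (p ∘ punchIn (suc v))  ∎
  where open ≡-Reasoning

countFin-< : ∀ {k} {p q : Fin k → Bool} → p ⊆ᵇ q → ∀ v → p v ≡ false → q v ≡ true →
             countFin p < countFin q
countFin-< {suc k} {p} {q} p⊆q v pv qv = begin-strict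
  countFin p
    ≡⟨ countFin-punchIn p v ⟩
  indicator (p v) + countFin (p ∘ punchIn v)
    ≡⟨ cong (λ b → indicator b + countFin (p ∘ punchIn v)) pv ⟩
  countFin (p ∘ punchIn v)
    <⟨ s≤s (countFin-mono (p⊆q ∘ punchIn v)) ⟩
  1 + countFin (q ∘ punchIn v)
    ≡⟨ cong (λ b → indicator b + countFin (q ∘ punchIn v)) qv ⟨
  indicator (q v) + countFin (q ∘ punchIn v)
    ≡⟨ countFin-punchIn q v ⟨
  countFin q  ∎
  where open ≤-Reasoning

countFin-≤-suc : ∀ {k} {p q : Fin k → Bool} v → (∀ w → w ≢ v → q w ≡ true → p w ≡ true) →
                 countFin q ≤ suc (countFin p)
countFin-≤-suc {suc k} {p} {q} v q⊆p-v = begin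
  countFin q
    ≡⟨ countFin-punchIn q v ⟩
  indicator (q v) + countFin (q ∘ punchIn v)
    ≤⟨ +-mono-≤ (indicator≤1 (q v)) (countFin-mono λ w → q⊆p-v (punchIn v w) (punchInᵢ≢i v w)) ⟩
  1 + countFin (p ∘ punchIn v)
    ≤⟨ s≤s (m≤n+m _ (indicator (p v))) ⟩
  1 + (indicator (p v) + countFin (p ∘ punchIn v))
    ≡⟨ cong suc (countFin-punchIn p v) ⟨
  suc (countFin p)  ∎
  where open ≤-Reasoning

countFin-+ : ∀ a b (p : Fin (a + b) → Bool) →
             countFin p ≡ countFin (λ i → p (i ↑ˡ b)) + countFin (λ j → p (a ↑ʳ j))
countFin-+ zero b p = refl
countFin-+ (suc a) b p = trans (cong (indicator (p zero) +_) (countFin-+ a b (p ∘ suc)))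
                               (sym (+-assoc (indicator (p zero)) _ _))

maxFin-ub : ∀ {k} (f : Fin k → ℕ) v → f v ≤ maxFin f
maxFin-ub f zero = m≤m⊔n _ _
maxFin-ub f (suc v) = ≤-trans (maxFin-ub (f ∘ suc) v) (m≤n⊔m _ _)

maxFin-lub : ∀ {k} (f : Fin k → ℕ) {c} → (∀ v → f v ≤ c) → maxFin f ≤ c
maxFin-lub {zero} f _ = z≤n
maxFin-lub {suc k} f f≤c = ⊔-lub (f≤c zero) (maxFin-lub (f ∘ suc) (f≤c ∘ suc))

allFinB-sound : ∀ {k} {p : Fin k → Bool} → allFinB p ≡ true → ∀ i → p i ≡ true
allFinB-sound {suc k} all zero = proj₁ (∧-true⁻ all)
allFinB-sound {suc k} all (suc i) = allFinB-sound (proj₂ (∧-true⁻ all)) i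

allFinB-complete : ∀ {k} {p : Fin k → Bool} → (∀ i → p i ≡ true) → allFinB p ≡ true
allFinB-complete {zero} _ = refl
allFinB-complete {suc k} all rewrite all zero = allFinB-complete (all ∘ suc)

_∈_ : ∀ {k} → Fin k → Subset k → Set
v ∈ S = lookup S v ≡ true

_∉_ : ∀ {k} → Fin k → Subset k → Set
v ∉ S = lookup S v ≡ false

insert : ∀ {k} → Fin k → Subset k → Subset k
insert v S = S [ v ]≔ true

lookup-≗⇒≡ : ∀ {k} {S T : Subset k} → (∀ v → lookup S v ≡ lookup T v) → S ≡ T
lookup-≗⇒≡ {S = S} {T} S≗T = begin
  S                  ≡⟨ tabulate∘lookup S ⟨
  tabulate (lookup S) ≡⟨ tabulate-cong S≗T ⟩
  tabulate (lookup T) ≡⟨ tabulate∘lookup T ⟩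
  T                  ∎
  where open ≡-Reasoning

∈-insert⁻ : ∀ {k} {u v : Fin k} S → u ∈ insert v S → u ≡ v ⊎ u ∈ S
∈-insert⁻ {u = u} {v} S u∈ with u Fin.≟ v
... | yes u≡v = inj₁ u≡v
... | no u≢v = inj₂ (trans (sym (lookup∘update′ u≢v S true)) u∈)

∣++∣ : ∀ {a b} (S : Subset a) (T : Subset b) → ∣ S ++ T ∣ ≡ ∣ S ∣ + ∣ T ∣
∣++∣ {a} {b} S T = trans (countFin-+ a b (lookup (S ++ T)))
  (cong₂ _+_ (countFin-cong (lookup-++ˡ S T)) (countFin-cong (lookup-++ʳ S T)))

∣replicate-true∣ : ∀ k → ∣ replicate k true ∣ ≡ k
∣replicate-true∣ k = countFin-true {k} λ i → lookup-replicate i true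

∣replicate-false∣ : ∀ k → ∣ replicate k false ∣ ≡ 0
∣replicate-false∣ k = countFin-false {k} λ i → lookup-replicate i false

∣insert∣ : ∀ {k} {v : Fin k} S → v ∉ S → ∣ insert v S ∣ ≡ suc ∣ S ∣
∣insert∣ {suc k} {v} S v∉S = begin
  ∣ insert v S ∣
    ≡⟨ countFin-punchIn (lookup (insert v S)) v ⟩
  indicator (lookup (insert v S) v) + countFin (lookup (insert v S) ∘ punchIn v)
    ≡⟨ cong₂ (λ b n → indicator b + n) (lookup∘update v S true)
             (countFin-cong λ w → lookup∘update′ (punchInᵢ≢i v w) S true) ⟩
  suc (countFin (lookup S ∘ punchIn v))
    ≡⟨ cong (λ b → suc (indicator b + countFin (lookup S ∘ punchIn v))) v∉S ⟨
  suc (indicator (lookup S v) + countFin (lookup S ∘ punchIn v))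
    ≡⟨ cong suc (countFin-punchIn (lookup S) v) ⟨
  suc ∣ S ∣  ∎
  where open ≡-Reasoning

⁅_⁆ : ∀ {k} → Fin k → Subset k
⁅ v ⁆ = insert v (replicate _ false)

∣⁅⁆∣ : ∀ {k} (v : Fin k) → ∣ ⁅ v ⁆ ∣ ≡ 1
∣⁅⁆∣ {k} v = trans (∣insert∣ (replicate k false) (lookup-replicate v false))
                   (cong suc (∣replicate-false∣ k))

∈⁅⁆⇒≡ : ∀ {k} (v : Fin k) {u} → u ∈ ⁅ v ⁆ → u ≡ v
∈⁅⁆⇒≡ {k} v {u} u∈ with ∈-insert⁻ (replicate k false) u∈
... | inj₁ u≡v = u≡v
... | inj₂ u∈∅ = contradiction (trans (sym u∈∅) (lookup-replicate u false)) λ ()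

∈-allSubsets : ∀ {k} (S : Subset k) → S ∈ₗ allSubsets k
∈-allSubsets [] = here refl
∈-allSubsets (true ∷ S) = ∈-++⁺ˡ (∈-map⁺ (true ∷_) (∈-allSubsets S))
∈-allSubsets {suc k} (false ∷ S) =
  ∈-++⁺ʳ (map (true ∷_) (allSubsets k)) (∈-map⁺ (false ∷_) (∈-allSubsets S))

module FilteredMax {A : Set} (P : A → Bool) (g : A → ℕ) where

  maxOf : List A → ℕ
  maxOf = foldr (λ S acc → if P S then g S ⊔ acc else acc) 0

  maxOf-ub : ∀ {L S} → S ∈ₗ L → P S ≡ true → g S ≤ maxOf L
  maxOf-ub {x ∷ L} (here refl) PS rewrite PS = m≤m⊔n _ _
  maxOf-ub {x ∷ L} (there S∈L) PS with P x
  ... | true = ≤-trans (maxOf-ub S∈L PS) (m≤n⊔m _ _)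
  ... | false = maxOf-ub S∈L PS

  maxOf-lub : ∀ {c} L → (∀ S → P S ≡ true → g S ≤ c) → maxOf L ≤ c
  maxOf-lub [] _ = z≤n
  maxOf-lub (x ∷ L) g≤c with P x in Px
  ... | true = ⊔-lub (g≤c x Px) (maxOf-lub L g≤c)
  ... | false = maxOf-lub L g≤c

  maxOf-attained : ∀ L → 0 < maxOf L → ∃ λ S → P S ≡ true × g S ≡ maxOf L
  maxOf-attained (x ∷ L) pos with P x in Px
  ... | false = maxOf-attained L pos
  ... | true with ⊔-sel (g x) (maxOf L)
  ...   | inj₁ max≡gx = x , Px , sym max≡gx
  ...   | inj₂ max≡rest with maxOf-attained L (subst (0 <_) max≡rest pos)
  ...     | S , PS , gS≡ = S , PS , trans gS≡ (sym max≡rest)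

insertMin : ℕ → Maybe ℕ → Maybe ℕ
insertMin x nothing = just x
insertMin x (just y) = just (x ⊓ y)

module FilteredMin {A : Set} (c : A → Bool) (f : A → ℕ) where

  MinStep : (A → Maybe ℕ → Maybe ℕ) → Set
  MinStep step = ∀ S acc → step S acc ≡ (if c S then insertMin (f S) acc else acc)

  Below : ℕ → Maybe ℕ → Set
  Below b r = ∃ λ y → r ≡ just y × y ≤ b

  module _ {step : A → Maybe ℕ → Maybe ℕ} (step-def : MinStep step) where

    minOf : List A → Maybe ℕ
    minOf = foldr step nothing

    step-below : ∀ S {b acc} → Below b acc → Below b (step S acc)
    step-below S {acc = acc} (y , refl , y≤b) rewrite step-def S acc with c S
    ... | true = f S ⊓ y , refl , ≤-trans (m⊓n≤n (f S) y) y≤b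
    ... | false = y , refl , y≤b

    minOf-below : ∀ {L S} → S ∈ₗ L → c S ≡ true → Below (f S) (minOf L)
    minOf-below {x ∷ L} (here refl) cx rewrite step-def x (minOf L) | cx with minOf L
    ... | nothing = f x , refl , ≤-refl
    ... | just y = f x ⊓ y , refl , m⊓n≤m (f x) y
    minOf-below {x ∷ L} (there S∈L) cS = step-below x (minOf-below S∈L cS)

    minOf-just : ∀ L {y} → minOf L ≡ just y → ∃ λ T → c T ≡ true × y ≡ f T
    minOf-just (x ∷ L) rewrite step-def x (minOf L) with c x in cx | minOf L | minOf-just L
    ... | false | _ | attained = attained
    ... | true | nothing | _ = λ { refl → x , cx , refl }
    ... | true | just z | attained with ⊓-sel (f x) z
    ...   | inj₁ min≡fx = λ { refl → x , cx , min≡fx }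
    ...   | inj₂ min≡z = λ { refl → let T , cT , z≡fT = attained refl in T , cT , trans min≡z z≡fT }

    min≤ : ∀ {L S} → S ∈ₗ L → c S ≡ true → fromMaybe 0 (minOf L) ≤ f S
    min≤ S∈L cS with minOf-below S∈L cS
    ... | y , r≡y , y≤fS rewrite r≡y = y≤fS

    min-attained : ∀ {L S} → S ∈ₗ L → c S ≡ true →
                   ∃ λ T → c T ≡ true × fromMaybe 0 (minOf L) ≡ f T
    min-attained {L} S∈L cS with minOf-below S∈L cS
    ... | y , r≡y , _ rewrite r≡y = minOf-just L r≡y

Independent : (G : Graph) → Subset (V G) → Set
Independent G S = ∀ {u v} → u ∈ S → v ∈ S → adj G u v ≡ false

isIndependent⇒Independent : ∀ G {S} → isIndependent G S ≡ true → Independent G S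
isIndependent⇒Independent G indep {u} {v} u∈S v∈S
  with allFinB-sound (allFinB-sound indep u) v
... | no-edge rewrite u∈S | v∈S = not-injective no-edge

Independent⇒isIndependent : ∀ G {S} → Independent G S → isIndependent G S ≡ true
Independent⇒isIndependent G {S} indep = allFinB-complete λ u → allFinB-complete λ v → no-edge u v
  where
  no-edge : ∀ u v → not (lookup S u ∧ (lookup S v ∧ adj G u v)) ≡ true
  no-edge u v with lookup S u in u∈S | lookup S v in v∈S
  ... | false | _ = refl
  ... | true | false = refl
  ... | true | true rewrite indep u∈S v∈S = refl

module _ (G : Graph) where
  open FilteredMax (isIndependent G) ∣_∣

  α-ub : ∀ S → Independent G S → ∣ S ∣ ≤ α G
  α-ub S indep = maxOf-ub (∈-allSubsets S) (Independent⇒isIndependent G {S} indep)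

  α-lub : ∀ {c} → (∀ S → Independent G S → ∣ S ∣ ≤ c) → α G ≤ c
  α-lub bound = maxOf-lub (allSubsets (V G)) λ S indep →
    bound S (isIndependent⇒Independent G {S} indep)

  α-attained : 0 < α G → ∃ λ S → Independent G S × ∣ S ∣ ≡ α G
  α-attained pos with maxOf-attained (allSubsets (V G)) pos
  ... | S , indep , size = S , isIndependent⇒Independent G {S} indep , size

-- σ's fold step uses an insertion function that Defs keeps private: min≤ and min-attained
-- receive it by unification with σ, and the pattern lambda checks that it behaves as insertMin.
module _ (G : Graph) where
  open FilteredMin (λ S → ⌊ α G <? ∣ S ∣ ⌋) (ΔS G)

  σ≤ΔS : ∀ S → α G < ∣ S ∣ → σ G ≤ ΔS G S
  σ≤ΔS S α<∣S∣ = min≤ (λ _ → λ { nothing → refl ; (just _) → refl })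
                        (∈-allSubsets S) (⇒⌊⌋≡true (α G <? ∣ S ∣) α<∣S∣)

  σ-attained : ∀ S → α G < ∣ S ∣ → ∃ λ T → α G < ∣ T ∣ × σ G ≡ ΔS G T
  σ-attained S α<∣S∣ = let T , α<ᵇ∣T∣ , σ≡ = attained in T , ⌊⌋≡true⇒ (α G <? ∣ T ∣) α<ᵇ∣T∣ , σ≡
    where
    attained : ∃ λ T → ⌊ α G <? ∣ T ∣ ⌋ ≡ true × σ G ≡ ΔS G T
    attained = min-attained (λ _ → λ { nothing → refl ; (just _) → refl })
                            (∈-allSubsets S) (⇒⌊⌋≡true (α G <? ∣ S ∣) α<∣S∣)

module _ (G : Graph) where

  degIn<∣S∣ : ∀ S {v} → v ∈ S → degIn G S v < ∣ S ∣
  degIn<∣S∣ S {v} v∈S = countFin-< (λ _ → proj₁ ∘ ∧-true⁻) v no-loop v∈S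
    where
    no-loop : lookup S v ∧ adj G v v ≡ false
    no-loop rewrite adj-irrefl G v = ∧-zeroʳ (lookup S v)

  ΔS≤pred∣S∣ : ∀ S → ΔS G S ≤ pred ∣ S ∣
  ΔS≤pred∣S∣ S = maxFin-lub _ term≤
    where
    term≤ : ∀ v → (if lookup S v then degIn G S v else 0) ≤ pred ∣ S ∣
    term≤ v with lookup S v in v∈S
    ... | true = pred-mono-≤ (degIn<∣S∣ S v∈S)
    ... | false = z≤n

  degIn≤ΔS : ∀ S {v} → v ∈ S → degIn G S v ≤ ΔS G S
  degIn≤ΔS S {v} v∈S = subst (_≤ ΔS G S) term≡ (maxFin-ub _ v)
    where
    term≡ : (if lookup S v then degIn G S v else 0) ≡ degIn G S v
    term≡ rewrite v∈S = refl

  Universal : Fin (V G) → Set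
  Universal v = ∀ w → w ≢ v → adj G v w ≡ true

  universal⇒∣S∣≤1+ΔS : ∀ {v} S → Universal v → v ∈ S → ∣ S ∣ ≤ suc (ΔS G S)
  universal⇒∣S∣≤1+ΔS {v} S univ v∈S = ≤-trans
    (countFin-≤-suc v λ w w≢v w∈S → cong₂ _∧_ w∈S (univ w w≢v))
    (s≤s (degIn≤ΔS S v∈S))

  universal⇒V≤1+Δ : ∀ {v} → Universal v → V G ≤ suc (Δ G)
  universal⇒V≤1+Δ {v} univ = subst (_≤ suc (Δ G)) (countFin-true (lookup∘tabulate (λ _ → true)))
    (universal⇒∣S∣≤1+ΔS (tabulate λ _ → true) univ (lookup∘tabulate (λ _ → true) v))

  universal-independent⇒∣S∣≤1 : ∀ {v} S → Universal v → Independent G S → v ∈ S → ∣ S ∣ ≤ 1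
  universal-independent⇒∣S∣≤1 {v} S univ indep v∈S =
    subst (λ n → ∣ S ∣ ≤ suc n) (countFin-false {V G} {λ _ → false} λ _ → refl)
      (countFin-≤-suc v λ w w≢v w∈S → contradiction (indep v∈S w∈S) (not-¬ (univ w w≢v)))

  0<α : Fin (V G) → 0 < α G
  0<α v = subst (_≤ α G) (∣⁅⁆∣ v) (α-ub G ⁅ v ⁆ ⁅v⁆-independent)
    where
    ⁅v⁆-independent : Independent G ⁅ v ⁆
    ⁅v⁆-independent u∈ w∈ rewrite ∈⁅⁆⇒≡ v u∈ | ∈⁅⁆⇒≡ v w∈ = adj-irrefl G v

  σ≤pred∣S∣ : ∀ S → α G < ∣ S ∣ → σ G ≤ pred ∣ S ∣
  σ≤pred∣S∣ S α<∣S∣ = ≤-trans (σ≤ΔS G S α<∣S∣) (ΔS≤pred∣S∣ S)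

  edge⇒∃∉independent : ∀ I {i j} → Independent G I → adj G i j ≡ true → ∃ λ u → u ∉ I
  edge⇒∃∉independent I {i} {j} indep edge with lookup I i in i∈I | lookup I j in j∈I
  ... | false | _ = i , i∈I
  ... | true | false = j , j∈I
  ... | true | true = contradiction (indep i∈I j∈I) (not-¬ edge)

  nonempty⇒∃∣S∣≡1+α : Nonempty G → ∃ λ S → ∣ S ∣ ≡ suc (α G)
  nonempty⇒∃∣S∣≡1+α (i , j , edge) with α-attained G (0<α i)
  ... | I , indep , ∣I∣≡α with edge⇒∃∉independent I indep edge
  ...   | u , u∉I = insert u I , trans (∣insert∣ I u∉I) (cong suc ∣I∣≡α)

  σ≤α : Nonempty G → σ G ≤ α G
  σ≤α nonempty with nonempty⇒∃∣S∣≡1+α nonempty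
  ... | S , ∣S∣≡1+α = subst (λ s → σ G ≤ pred s) ∣S∣≡1+α (σ≤pred∣S∣ S (≤-reflexive (sym ∣S∣≡1+α)))

K-adj : ∀ {n} {b b' : Fin n} → b ≢ b' → adj (K n) b b' ≡ true
K-adj {b = b} {b'} b≢b' = cong not (trans (isYes≗does (b Fin.≟ b')) (dec-false (b Fin.≟ b') b≢b'))

module Join (G : Graph) (n : ℕ) where

  H : Graph
  H = G ⋁ K n

  fromG : Fin (V G) → Fin (V H)
  fromG a = a ↑ˡ n

  fromK : Fin n → Fin (V H)
  fromK b = V G ↑ʳ b

  data JoinView : Fin (V H) → Set where
    inG : ∀ a → JoinView (fromG a)
    inK : ∀ b → JoinView (fromK b)

  view : ∀ i → JoinView i
  view i with splitAt (V G) i | join-splitAt (V G) n i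
  ... | inj₁ a | refl = inG a
  ... | inj₂ b | refl = inK b

  adj-GG : ∀ a a' → adj H (fromG a) (fromG a') ≡ adj G a a'
  adj-GG a a' rewrite splitAt-↑ˡ (V G) a n | splitAt-↑ˡ (V G) a' n = refl

  adj-KG : ∀ b a → adj H (fromK b) (fromG a) ≡ true
  adj-KG b a rewrite splitAt-↑ʳ (V G) n b | splitAt-↑ˡ (V G) a n = refl

  adj-KK : ∀ b b' → adj H (fromK b) (fromK b') ≡ adj (K n) b b'
  adj-KK b b' rewrite splitAt-↑ʳ (V G) n b | splitAt-↑ʳ (V G) n b' = refl

  fromK-universal : ∀ b → Universal H (fromK b)
  fromK-universal b w w≢ with view w
  ... | inG a = adj-KG b a
  ... | inK b' = trans (adj-KK b b') (K-adj λ b≡b' → w≢ (cong fromK (sym b≡b')))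

  lift : Subset (V G) → Subset (V H)
  lift S = S ++ replicate n false

  lookup-lift-G : ∀ S a → lookup (lift S) (fromG a) ≡ lookup S a
  lookup-lift-G S a = lookup-++ˡ S (replicate n false) a

  fromK∉lift : ∀ S b → fromK b ∉ lift S
  fromK∉lift S b = trans (lookup-++ʳ S (replicate n false) b) (lookup-replicate b false)

  ∣lift∣ : ∀ S → ∣ lift S ∣ ≡ ∣ S ∣
  ∣lift∣ S = trans (∣++∣ S (replicate n false))
                   (trans (cong (∣ S ∣ +_) (∣replicate-false∣ n)) (+-identityʳ ∣ S ∣))

  degIn-lift : ∀ S a → degIn H (lift S) (fromG a) ≡ degIn G S a
  degIn-lift S a = trans (countFin-+ (V G) n _)
    (trans (cong₂ _+_ (countFin-cong λ a' → cong₂ _∧_ (lookup-lift-G S a') (adj-GG a a'))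
                      (countFin-false λ b → cong (_∧ _) (fromK∉lift S b)))
           (+-identityʳ (degIn G S a)))

  ΔS-lift : ∀ S → ΔS H (lift S) ≡ ΔS G S
  ΔS-lift S = ≤-antisym
    (maxFin-lub _ λ v → term≤ v (view v))
    (maxFin-lub _ λ a → subst (_≤ ΔS H (lift S)) (term-G a) (maxFin-ub _ (fromG a)))
    where
    term-G : ∀ a → (if lookup (lift S) (fromG a) then degIn H (lift S) (fromG a) else 0)
                 ≡ (if lookup S a then degIn G S a else 0)
    term-G a rewrite lookup-lift-G S a | degIn-lift S a = refl

    term≤ : ∀ v → JoinView v → (if lookup (lift S) v then degIn H (lift S) v else 0) ≤ ΔS G S
    term≤ _ (inG a) = subst (_≤ ΔS G S) (sym (term-G a)) (maxFin-ub _ a)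
    term≤ _ (inK b) rewrite fromK∉lift S b = z≤n

  lift-Independent : ∀ S → Independent G S → Independent H (lift S)
  lift-Independent S indep {u} {w} u∈ w∈ = no-edge (view u) (view w) u∈ w∈
    where
    no-edge : ∀ {u w} → JoinView u → JoinView w → u ∈ lift S → w ∈ lift S → adj H u w ≡ false
    no-edge (inG a) (inG a') a∈ a'∈ = trans (adj-GG a a')
      (indep (trans (sym (lookup-lift-G S a)) a∈) (trans (sym (lookup-lift-G S a')) a'∈))
    no-edge _ (inK b) _ b∈ = contradiction (trans (sym b∈) (fromK∉lift S b)) λ ()
    no-edge (inK b) _ b∈ _ = contradiction (trans (sym b∈) (fromK∉lift S b)) λ ()

  lift-Independent⁻ : ∀ S → Independent H (lift S) → Independent G S
  lift-Independent⁻ S indep {a} {a'} a∈ a'∈ =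
    trans (sym (adj-GG a a'))
          (indep (trans (lookup-lift-G S a) a∈) (trans (lookup-lift-G S a') a'∈))

  fromK∈⊎lift : ∀ S → (∃ λ b → fromK b ∈ S) ⊎ (∃ λ R → S ≡ lift R)
  fromK∈⊎lift S with any? (λ b → lookup S (fromK b) Bool.≟ true)
  ... | yes fromK∈S = inj₁ fromK∈S
  ... | no fromK∉S = inj₂ (restrict , lookup-≗⇒≡ same)
    where
    restrict : Subset (V G)
    restrict = tabulate (lookup S ∘ fromG)

    same : ∀ v → lookup S v ≡ lookup (lift restrict) v
    same v with view v
    ... | inG a = sym (trans (lookup-lift-G restrict a) (lookup∘tabulate (lookup S ∘ fromG) a))
    ... | inK b = trans (¬-not λ b∈S → fromK∉S (b , b∈S)) (sym (fromK∉lift restrict b))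

  α-join-≤ : ∀ {c} → 1 ≤ c → (∀ S → Independent G S → ∣ S ∣ ≤ c) → α H ≤ c
  α-join-≤ {c} 1≤c bound = α-lub H ∣S∣≤c
    where
    ∣S∣≤c : ∀ S → Independent H S → ∣ S ∣ ≤ c
    ∣S∣≤c S indep with fromK∈⊎lift S
    ... | inj₁ (b , b∈S) =
            ≤-trans (universal-independent⇒∣S∣≤1 H S (fromK-universal b) indep b∈S) 1≤c
    ... | inj₂ (R , refl) = subst (_≤ c) (sym (∣lift∣ R)) (bound R (lift-Independent⁻ R indep))

  α≤α-join : α G ≤ α H
  α≤α-join = α-lub G λ S indep →
    subst (_≤ α H) (∣lift∣ S) (α-ub H (lift S) (lift-Independent S indep))

  α-join : 0 < α G → α H ≡ α G
  α-join 0<αG = ≤-antisym (α-join-≤ 0<αG (α-ub G)) α≤α-join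

  σ-join-≥ : ∀ {c} S → α H < ∣ S ∣ → c ≤ α H → (∀ R → α H < ∣ R ∣ → c ≤ ΔS G R) → c ≤ σ H
  σ-join-≥ S α<∣S∣ c≤α bound with σ-attained H S α<∣S∣
  ... | T , α<∣T∣ , σ≡ΔT rewrite σ≡ΔT with fromK∈⊎lift T
  ...   | inj₁ (b , b∈T) =
          ≤-trans c≤α (≤-pred (≤-trans α<∣T∣ (universal⇒∣S∣≤1+ΔS H T (fromK-universal b) b∈T)))
  ...   | inj₂ (R , refl) rewrite ΔS-lift R = bound R (subst (α H <_) (∣lift∣ R) α<∣T∣)

  σ-join-≤ : ∀ {k} (T : Subset n) → ∣ T ∣ ≡ suc k → α H ≤ V G + k → σ H ≤ V G + k
  σ-join-≤ {k} T ∣T∣≡1+k α≤ =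
    subst (λ s → σ H ≤ pred s) size (σ≤pred∣S∣ H S (subst (α H <_) (sym size) (s≤s α≤)))
    where
    S : Subset (V H)
    S = replicate (V G) true ++ T
    size : ∣ S ∣ ≡ suc (V G + k)
    size = trans (∣++∣ (replicate (V G) true) T)
                 (trans (cong₂ _+_ (∣replicate-true∣ (V G)) ∣T∣≡1+k) (+-suc (V G) k))

Δ-join : ∀ G n → V G + n ≤ Δ (G ⋁ K (suc n))
Δ-join G n =
  ≤-pred (subst (_≤ suc (Δ H)) (+-suc (V G) n) (universal⇒V≤1+Δ H (fromK-universal zero)))
  where open Join G (suc n)

σ-join-nonempty : ∀ G n → Nonempty G → σ (G ⋁ K n) ≡ σ G
σ-join-nonempty G n nonempty = ≤-antisym σH≤σG σG≤σH
  where
  open Join G n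

  αH≡αG : α H ≡ α G
  αH≡αG = α-join (0<α G (proj₁ nonempty))

  exceeds : ∀ S → α G < ∣ S ∣ → α H < ∣ lift S ∣
  exceeds S α<∣S∣ = subst₂ _<_ (sym αH≡αG) (sym (∣lift∣ S)) α<∣S∣

  σH≤σG : σ H ≤ σ G
  σH≤σG with nonempty⇒∃∣S∣≡1+α G nonempty
  ... | S , ∣S∣≡1+α with σ-attained G S (≤-reflexive (sym ∣S∣≡1+α))
  ...   | T , α<∣T∣ , σ≡ΔT = begin
    σ H            ≤⟨ σ≤ΔS H (lift T) (exceeds T α<∣T∣) ⟩
    ΔS H (lift T)  ≡⟨ ΔS-lift T ⟩
    ΔS G T         ≡⟨ σ≡ΔT ⟨
    σ G            ∎
    where open ≤-Reasoning

  σG≤σH : σ G ≤ σ H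
  σG≤σH with nonempty⇒∃∣S∣≡1+α G nonempty
  ... | S , ∣S∣≡1+α = σ-join-≥ (lift S) (exceeds S (≤-reflexive (sym ∣S∣≡1+α)))
    (subst (σ G ≤_) (sym αH≡αG) (σ≤α G nonempty))
    (λ R α<∣R∣ → σ≤ΔS G R (subst (_< ∣ R ∣) αH≡αG α<∣R∣))

α-Kbar : ∀ m → α (Kbar m) ≡ m
α-Kbar m = ≤-antisym (α-lub (Kbar m) λ S _ → countFin≤ (lookup S))
  (subst (_≤ α (Kbar m)) (∣replicate-true∣ m) (α-ub (Kbar m) (replicate m true) λ _ _ → refl))

σ-Kbar-join : ∀ m n → 1 ≤ m → 1 ≤ n → σ (Kbar m ⋁ K n) ≡ m
σ-Kbar-join m (suc n) 1≤m _ = ≤-antisym σH≤m m≤σH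
  where
  open Join (Kbar m) (suc n)

  αH≡m : α H ≡ m
  αH≡m = trans (α-join (subst (1 ≤_) (sym (α-Kbar m)) 1≤m)) (α-Kbar m)

  σH≤m : σ H ≤ m
  σH≤m = subst (σ H ≤_) (+-identityʳ m)
    (σ-join-≤ (true ∷ replicate n false) (cong suc (∣replicate-false∣ n))
              (≤-reflexive (trans αH≡m (sym (+-identityʳ m)))))

  m≤σH : m ≤ σ H
  m≤σH = σ-join-≥ (replicate (V H) true) m<V (≤-reflexive (sym αH≡m))
    λ R α<∣R∣ → contradiction (subst (_< ∣ R ∣) αH≡m α<∣R∣) (≤⇒≯ (countFin≤ (lookup R)))
    where
    m<V : α H < ∣ replicate (V H) true ∣
    m<V rewrite αH≡m | ∣replicate-true∣ (m + suc n) = m<m+n m (s≤s z≤n)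

≥id⇒TendsToInfinity : ∀ {f} → (∀ k → k ≤ f k) → TendsToInfinity f
≥id⇒TendsToInfinity k≤f B = B , λ k B≤k → ≤-trans B≤k (k≤f k)

bounded-on-suc⇒¬TendsToInfinity : ∀ {f} B → (∀ k → f (suc k) ≤ B) → ¬ TendsToInfinity f
bounded-on-suc⇒¬TendsToInfinity B bound tends with tends (suc B)
... | N , large = <-irrefl refl (≤-trans (large (suc N) (n≤1+n N)) (bound N))

join-complete-insensitive : ∀ G → Insensitive (λ k → G ⋁ K (suc k))
join-complete-insensitive G =
    ≥id⇒TendsToInfinity (λ k → ≤-trans (m≤n+m k (V G)) (Δ-join G k))
  , bounded-on-suc⇒¬TendsToInfinity (V G + 1) σ≤
  where
  σ≤ : ∀ k → σ (G ⋁ K (suc (suc k))) ≤ V G + 1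
  σ≤ k = σ-join-≤ (true ∷ true ∷ replicate k false) (cong (λ c → suc (suc c)) (∣replicate-false∣ k))
    (α-join-≤ (m≤n+m 1 (V G)) λ S _ → ≤-trans (countFin≤ (lookup S)) (m≤m+n (V G) 1))
    where open Join G (suc (suc k))

Kbar-join-sensitive : ∀ n → 1 ≤ n → Sensitive (λ k → Kbar (suc k) ⋁ K n)
Kbar-join-sensitive (suc n) 1≤n =
    ≥id⇒TendsToInfinity (λ k → ≤-trans (≤-trans (n≤1+n k) (m≤m+n (suc k) n))
                                        (Δ-join (Kbar (suc k)) n))
  , ≥id⇒TendsToInfinity (λ k → ≤-trans (n≤1+n k)
                                  (≤-reflexive (sym (σ-Kbar-join (suc k) (suc n) (s≤s z≤n) 1≤n))))

corollary3p4 : ((G : Graph) (n : ℕ) → 1 ≤ n → Nonempty G → σ (G ⋁ K n) ≡ σ G)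
    × ((m n : ℕ) → 1 ≤ m → 1 ≤ n → σ (Kbar m ⋁ K n) ≡ m)
    × ((G : Graph) → Insensitive (λ k → G ⋁ K (suc k)))
    × ((n : ℕ) → 1 ≤ n → Sensitive (λ k → Kbar (suc k) ⋁ K n))
-- The first part does not need 1 ≤ n.
corollary3p4 = (λ G n _ → σ-join-nonempty G n)
             , σ-Kbar-join
             , join-complete-insensitive
             , Kbar-join-sensitive
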